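{- Let $p$ be a prime with $p\equiv 1\bmod 4$, let $k\ge 1$, and let $a$ be an integer not divisible by $p$. Then $c_2(a;p^k)=1$.
   Context: For $n\ge2$ and $a$ coprime to $n$, $H_2(a;n)=\{(x,y)\in\mathbb{Z}^2: xy\equiv a \bmod n,\ 1\le x,y<n\}$, $\bar{S}_2(a;n)=\{x+y \bmod n:(x,y)\in H_2(a;n)\}$, $\bar{D}_2(a;n)=\{x-y \bmod n:(x,y)\in H_2(a;n)\}$, and $c_2(a;n)=\#\bar{S}_2(a;n)/\#\bar{D}_2(a;n)$. -}

module Defs where

open import Data.Nat using (ℕ; zero; suc; _+_; _*_; _∸_; _^_; _<_; _≤_; NonZero)
open import Data.Nat.DivMod using (_%_)
open import Data.Integer as ℤ using (ℤ; +_)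
import Data.Integer.DivMod as ℤD
open import Data.List using (List; []; _∷_; filter; length; upTo; concatMap; map; any)
open import Data.Bool using (Bool; true; false; _∧_)
open import Data.Product using (_×_; _,_)
open import Relation.Nullary.Decidable using (⌊_⌋)
open import Data.Rational using (ℚ; _/_; 0ℚ)
import Data.Nat as ℕ

_modℤ_ : ℤ → (n : ℕ) → .{{NonZero n}} → ℕ
a modℤ n = a ℤD.%ℕ n

range1 : ℕ → List ℕ
range1 n = filter (λ x → 1 ℕ.≤? x) (upTo n)

H₂ : ℤ → (n : ℕ) → .{{NonZero n}} → List (ℕ × ℕ)
H₂ a n = filter (λ xy → ((Data.Product.proj₁ xy * Data.Product.proj₂ xy) % n) ℕ.≟ (a modℤ n))
               (concatMap (λ x → map (λ y → (x , y)) (range1 n)) (range1 n))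

S̄₂ : ℤ → (n : ℕ) → .{{NonZero n}} → List ℕ
S̄₂ a n = filter (λ r → Data.List.Relation.Unary.Any.any?
                     (λ xy → ((Data.Product.proj₁ xy + Data.Product.proj₂ xy) % n) ℕ.≟ r)
                     (H₂ a n))
                (upTo n)
  where import Data.List.Relation.Unary.Any

-- D̄₂(a;n) = {x - y mod n}; x - y mod n is computed as (x + (n - y)) mod n since y < n
D̄₂ : ℤ → (n : ℕ) → .{{NonZero n}} → List ℕ
D̄₂ a n = filter (λ r → Data.List.Relation.Unary.Any.any?
                     (λ xy → ((Data.Product.proj₁ xy + (n ∸ Data.Product.proj₂ xy)) % n) ℕ.≟ r)
                     (H₂ a n))
                (upTo n)
  where import Data.List.Relation.Unary.Any

-- c₂(a;n) = #S̄₂ / #D̄₂ as a rational number (set to 0 if D̄₂ were empty,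
-- which does not occur for a coprime to n)
c₂ : ℤ → (n : ℕ) → .{{NonZero n}} → ℚ
c₂ a n with length (D̄₂ a n)
... | zero  = 0ℚ
... | suc d = (+ length (S̄₂ a n)) / suc d

module Submission where

open import Defs
open import Data.Nat using (ℕ; suc; _^_; _≤_; NonZero)
open import Data.Nat.Primality using (Prime; prime⇒nonZero)
open import Data.Nat.DivMod using (_%_)
open import Data.Nat.Properties using (m^n≢0)
open import Data.Integer using (ℤ; +_)
open import Data.Integer.Divisibility using (_∣_)
open import Data.Rational using (1ℚ)
open import Relation.Binary.PropositionalEquality using (_≡_)
open import Relation.Nullary using (¬_)

open import Data.Nat using (zero; _<_; z≤n; s≤s)
import Data.Nat as ℕ
import Data.Nat.Properties as ℕ
import Data.Nat.Divisibility as ℕ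
open import Data.Nat.DivMod using (m%n<n; m<n⇒m%n≡m; m*n%n≡0; m≡m%n+[m/n]*n)
open import Data.Nat.Primality using (euclidsLemma; prime⇒nonTrivial)
open import Data.Nat.Coprimality using (Coprime; coprime-Bézout; prime⇒coprime)
import Data.Nat.Coprimality as Coprime
open import Data.Nat.GCD using (module Bézout)
open import Data.Integer using (_+_; _*_; -_; _-_; 0ℤ; 1ℤ; -1ℤ)
import Data.Integer as ℤ
import Data.Integer.Properties as ℤ
open import Data.Integer.DivMod using (_%ℕ_; _/ℕ_; n%ℕd<d; a≡a%ℕn+[a/ℕn]*n)
open import Data.Integer.Divisibility.Signed as Signed
  using (divides; ∣⇒∣ᵤ; ∣ᵤ⇒∣; ∣m∣n⇒∣m+n; ∣m⇒∣-m; ∣m⇒∣m*n; ∣n⇒∣m*n)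
open import Data.Integer.Tactic.RingSolver using (solve-∀)
open import Data.Rational using (_/_)
open import Data.Rational.Properties using (fromℚᵘ-cong)
open import Data.Rational.Unnormalised using (mkℚᵘ; *≡*)
open import Data.Bool using (if_then_else_)
open import Data.List using ([_]; _++_; map; concatMap; filter; length; upTo)
import Data.List.Properties as List
open import Data.List.Membership.Propositional using (_∈_; find; lose)
open import Data.List.Membership.Propositional.Properties
  using (∈-filter⁺; ∈-filter⁻; ∈-concatMap⁺; ∈-concatMap⁻; ∈-map⁺; ∈-map⁻; ∈-upTo⁺; ∈-upTo⁻)
open import Data.List.Relation.Unary.Any using (Any; any?)
open import Data.Product using (∃; ∃₂; _×_; _,_; proj₁; proj₂)
open import Data.Sum using (_⊎_; inj₁; inj₂)
open import Function using (_∘_)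
open import Level using (0ℓ)
open import Relation.Binary.Bundles using (Setoid)
import Relation.Binary.Reasoning.Setoid
open import Relation.Binary.PropositionalEquality
  using (_≢_; refl; sym; trans; cong; cong₂; subst; module ≡-Reasoning)
open import Relation.Nullary using (Dec; yes; no; does; contradiction)
open import Relation.Unary using (Pred; Decidable; _∩_; ∁)
open import Relation.Unary.Properties using (_∩?_; ∁?)

-- If i² ≡ −1 (mod n), then (x , y) ↦ (ix , −iy) permutes the modular hyperbola
-- xy ≡ a and turns the difference x − y into the sum i(x − y); multiplication by
-- ±i therefore gives mutually inverse injections between the residues of
-- differences and of sums, so c₂(a;n) = 1. For n = pᵏ with p = 2m + 1 and m even,
-- such an i exists: on {2,…,m} pair x with the unique y ∈ {1,…,m} with xy ≡ ±1;
-- y ≠ 1, and as the set has odd size m − 1 some x is its own partner, which forces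
-- x² ≡ −1. A square root of −1 modulo p lifts to pᵏ by Hensel's lemma.

-- Congruences of integers

infix 4 _≡_mod_
data _≡_mod_ (u v : ℤ) (n : ℕ) : Set where
  mk≡mod : + n Signed.∣ u - v → u ≡ v mod n

module _ {n : ℕ} where

  ≡⇒≡mod : ∀ {u v} → u ≡ v → u ≡ v mod n
  ≡⇒≡mod {u} refl = mk≡mod (divides 0ℤ (ℤ.+-inverseʳ u))

  ≡mod-refl : ∀ {u} → u ≡ u mod n
  ≡mod-refl = ≡⇒≡mod refl

  ≡mod-sym : ∀ {u v} → u ≡ v mod n → v ≡ u mod n
  ≡mod-sym {u} {v} (mk≡mod d) = mk≡mod (subst (+ n Signed.∣_) (regroup u v) (∣m⇒∣-m d))
    where regroup : ∀ u v → - (u - v) ≡ v - u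
          regroup = solve-∀

  ≡mod-trans : ∀ {u v w} → u ≡ v mod n → v ≡ w mod n → u ≡ w mod n
  ≡mod-trans {u} {v} {w} (mk≡mod d) (mk≡mod e) =
    mk≡mod (subst (+ n Signed.∣_) (regroup u v w) (∣m∣n⇒∣m+n d e))
    where regroup : ∀ u v w → (u - v) + (v - w) ≡ u - w
          regroup = solve-∀

  +-cong-mod : ∀ {u v u′ v′} → u ≡ v mod n → u′ ≡ v′ mod n → u + u′ ≡ v + v′ mod n
  +-cong-mod {u} {v} {u′} {v′} (mk≡mod d) (mk≡mod e) =
    mk≡mod (subst (+ n Signed.∣_) (regroup u v u′ v′) (∣m∣n⇒∣m+n d e))
    where regroup : ∀ u v u′ v′ → (u - v) + (u′ - v′) ≡ (u + u′) - (v + v′)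
          regroup = solve-∀

  *-cong-mod : ∀ {u v u′ v′} → u ≡ v mod n → u′ ≡ v′ mod n → u * u′ ≡ v * v′ mod n
  *-cong-mod {u} {v} {u′} {v′} (mk≡mod d) (mk≡mod e) =
    mk≡mod (subst (+ n Signed.∣_) (regroup u v u′ v′) (∣m∣n⇒∣m+n (∣m⇒∣m*n u′ d) (∣n⇒∣m*n v e)))
    where regroup : ∀ u v u′ v′ → (u - v) * u′ + v * (u′ - v′) ≡ u * u′ - v * v′
          regroup = solve-∀

  neg-cong-mod : ∀ {u v} → u ≡ v mod n → - u ≡ - v mod n
  neg-cong-mod {u} {v} (mk≡mod d) = mk≡mod (subst (+ n Signed.∣_) (regroup u v) (∣m⇒∣-m d))
    where regroup : ∀ u v → - (u - v) ≡ - u - - v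
          regroup = solve-∀

  +-congˡ-mod : ∀ w {u v} → u ≡ v mod n → w + u ≡ w + v mod n
  +-congˡ-mod w = +-cong-mod (≡mod-refl {w})

  +-congʳ-mod : ∀ w {u v} → u ≡ v mod n → u + w ≡ v + w mod n
  +-congʳ-mod w u≡v = +-cong-mod u≡v (≡mod-refl {w})

  *-congˡ-mod : ∀ w {u v} → u ≡ v mod n → w * u ≡ w * v mod n
  *-congˡ-mod w = *-cong-mod (≡mod-refl {w})

  *-congʳ-mod : ∀ w {u v} → u ≡ v mod n → u * w ≡ v * w mod n
  *-congʳ-mod w u≡v = *-cong-mod u≡v (≡mod-refl {w})

  n≡0-mod : + n ≡ 0ℤ mod n
  n≡0-mod = mk≡mod (divides 1ℤ (trans (ℤ.+-identityʳ (+ n)) (sym (ℤ.*-identityˡ (+ n)))))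

  ≡0-mod⇒∣ : ∀ {u} → u ≡ 0ℤ mod n → + n Signed.∣ u
  ≡0-mod⇒∣ {u} (mk≡mod d) = subst (+ n Signed.∣_) (ℤ.+-identityʳ u) d

  %ℕ-≡mod : ∀ u .{{_ : NonZero n}} → + (u %ℕ n) ≡ u mod n
  %ℕ-≡mod u = mk≡mod (divides (- (u /ℕ n)) (remainder-minus (a≡a%ℕn+[a/ℕn]*n u n)))
    where
    remainder-minus : u ≡ + (u %ℕ n) + (u /ℕ n) * + n → + (u %ℕ n) - u ≡ - (u /ℕ n) * + n
    remainder-minus eq = trans (cong (λ z → + (u %ℕ n) - z) eq) (cancel (+ (u %ℕ n)) (u /ℕ n) (+ n))
      where cancel : ∀ r q m → r - (r + q * m) ≡ - q * m
            cancel = solve-∀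

  mod-setoid : Setoid 0ℓ 0ℓ
  mod-setoid = record
    { Carrier       = ℤ
    ; _≈_           = _≡_mod n
    ; isEquivalence = record { refl = ≡mod-refl ; sym = ≡mod-sym ; trans = ≡mod-trans }
    }

module ≡mod-Reasoning (n : ℕ) = Relation.Binary.Reasoning.Setoid (mod-setoid {n})

∸-≡mod : ∀ {n y} → y ≤ n → + (n ℕ.∸ y) ≡ - + y mod n
∸-≡mod {n} {y} y≤n = begin
  + (n ℕ.∸ y)  ≡⟨ trans (ℤ.m-n≡m⊖n n y) (ℤ.⊖-≥ y≤n) ⟨
  + n - + y    ≈⟨ +-congʳ-mod (- + y) n≡0-mod ⟩
  0ℤ - + y     ≡⟨ ℤ.+-identityˡ (- + y) ⟩
  - + y        ∎
  where open ≡mod-Reasoning n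

∣∧<⇒≡0 : ∀ {n d} → n ℕ.∣ d → d < n → d ≡ 0
∣∧<⇒≡0 {d = zero}  _   _   = refl
∣∧<⇒≡0 {d = suc d} n∣d d<n = contradiction (ℕ.∣⇒≤ n∣d) (ℕ.<⇒≱ d<n)

residue-unique-≤ : ∀ {n r r′} → r ≤ r′ → r′ < n → + r ≡ + r′ mod n → r ≡ r′
residue-unique-≤ {n} {r} {r′} r≤r′ r′<n (mk≡mod d) =
  ℕ.≤-antisym r≤r′ (ℕ.m∸n≡0⇒m≤n (∣∧<⇒≡0 n∣r′∸r (ℕ.≤-<-trans (ℕ.m∸n≤m r′ r) r′<n)))
  where n∣r′∸r : n ℕ.∣ r′ ℕ.∸ r
        n∣r′∸r = subst (n ℕ.∣_) (trans (cong ℤ.∣_∣ (ℤ.m-n≡m⊖n r r′)) (ℤ.∣⊖∣-≤ r≤r′))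
                   (∣⇒∣ᵤ d)

residue-unique : ∀ {n r r′} → r < n → r′ < n → + r ≡ + r′ mod n → r ≡ r′
residue-unique {r = r} {r′} r<n r′<n r≡r′ with ℕ.≤-total r r′
... | inj₁ r≤r′ = residue-unique-≤ r≤r′ r′<n r≡r′
... | inj₂ r′≤r = sym (residue-unique-≤ r′≤r r<n (≡mod-sym r≡r′))

≡mod⇒%-≡ : ∀ {x y} n .{{_ : NonZero n}} → + x ≡ + y mod n → x % n ≡ y % n
≡mod⇒%-≡ {x} {y} n x≡y = residue-unique (m%n<n x n) (m%n<n y n)
  (≡mod-trans (%ℕ-≡mod (+ x)) (≡mod-trans x≡y (≡mod-sym (%ℕ-≡mod (+ y)))))

≡mod⇒%≡ : ∀ {m r} n .{{_ : NonZero n}} → r < n → + m ≡ + r mod n → m % n ≡ r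
≡mod⇒%≡ n r<n m≡r = trans (≡mod⇒%-≡ n m≡r) (m<n⇒m%n≡m r<n)

%≡⇒≡mod : ∀ {m r} n .{{_ : NonZero n}} → m % n ≡ r → + m ≡ + r mod n
%≡⇒≡mod {m} n m%n≡r = ≡mod-trans (≡mod-sym (%ℕ-≡mod (+ m))) (≡⇒≡mod (cong +_ m%n≡r))

unit-scaling-injective : ∀ {n} .{{_ : NonZero n}} u w {r r′} → u * w ≡ 1ℤ mod n → r < n → r′ < n →
                         (w * + r) %ℕ n ≡ (w * + r′) %ℕ n → r ≡ r′
unit-scaling-injective {n} u w {r} {r′} uw≡1 r<n r′<n wr≡wr′ = residue-unique r<n r′<n (begin
  + r                       ≈⟨ cancel r ⟨
  u * (w * + r)             ≈⟨ *-congˡ-mod u (%ℕ-≡mod (w * + r)) ⟨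
  u * + ((w * + r) %ℕ n)    ≡⟨ cong (λ s → u * + s) wr≡wr′ ⟩
  u * + ((w * + r′) %ℕ n)   ≈⟨ *-congˡ-mod u (%ℕ-≡mod (w * + r′)) ⟩
  u * (w * + r′)            ≈⟨ cancel r′ ⟩
  + r′                      ∎)
  where
  open ≡mod-Reasoning n
  cancel : ∀ s → u * (w * + s) ≡ + s mod n
  cancel s = begin
    u * (w * + s)   ≡⟨ ℤ.*-assoc u w (+ s) ⟨
    (u * w) * + s   ≈⟨ *-congʳ-mod (+ s) uw≡1 ⟩
    1ℤ * + s        ≡⟨ ℤ.*-identityˡ (+ s) ⟩
    + s             ∎

pos-1+m*n : ∀ m n → + (1 ℕ.+ m ℕ.* n) ≡ 1ℤ + + m * + n
pos-1+m*n m n = trans (ℤ.pos-+ 1 (m ℕ.* n)) (cong (λ k → 1ℤ + k) (ℤ.pos-* m n))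

coprime⇒inverse-mod : ∀ {x n} → Coprime x n → ∃ λ u → + x * u ≡ 1ℤ mod n
coprime⇒inverse-mod {x} {n} x⊥n with coprime-Bézout x⊥n
... | Bézout.+- u v 1+vn≡ux = + u , mk≡mod (divides (+ v) (begin
  + x * + u - 1ℤ         ≡⟨ cong (_- 1ℤ) (trans (ℤ.*-comm (+ x) (+ u)) (sym (ℤ.pos-* u x))) ⟩
  + (u ℕ.* x) - 1ℤ       ≡⟨ cong (_- 1ℤ) (trans (sym (pos-1+m*n v n)) (cong +_ 1+vn≡ux)) ⟨
  1ℤ + + v * + n - 1ℤ    ≡⟨ cancel (+ v * + n) ⟩
  + v * + n              ∎))
  where open ≡-Reasoning
        cancel : ∀ m → 1ℤ + m - 1ℤ ≡ m
        cancel = solve-∀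
... | Bézout.-+ u v 1+ux≡vn = - + u , mk≡mod (divides (- + v) (begin
  + x * - + u - 1ℤ       ≡⟨ regroup (+ x) (+ u) ⟩
  - (1ℤ + + u * + x)     ≡⟨ cong -_ (trans (sym (pos-1+m*n u x)) (trans (cong +_ 1+ux≡vn) (ℤ.pos-* v n))) ⟩
  - (+ v * + n)          ≡⟨ ℤ.neg-distribˡ-* (+ v) (+ n) ⟩
  - + v * + n            ∎))
  where open ≡-Reasoning
        regroup : ∀ x u → x * - u - 1ℤ ≡ - (1ℤ + u * x)
        regroup = solve-∀

prime-∣-* : ∀ {p} → Prime p → ∀ u v → + p Signed.∣ u * v → + p Signed.∣ u ⊎ + p Signed.∣ v
prime-∣-* {p} p-prime u v p∣uv
  with euclidsLemma ℤ.∣ u ∣ ℤ.∣ v ∣ p-prime (subst (p ℕ.∣_) (ℤ.abs-* u v) (∣⇒∣ᵤ p∣uv))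
... | inj₁ p∣u = inj₁ (∣ᵤ⇒∣ p∣u)
... | inj₂ p∣v = inj₂ (∣ᵤ⇒∣ p∣v)

prime-square-≡⇒± : ∀ {p} → Prime p → ∀ u v → u * u ≡ v * v mod p → u ≡ v mod p ⊎ u ≡ - v mod p
prime-square-≡⇒± {p} p-prime u v (mk≡mod p∣u²-v²)
  with prime-∣-* p-prime (u - v) (u + v) (subst (+ p Signed.∣_) (difference-of-squares u v) p∣u²-v²)
  where difference-of-squares : ∀ u v → u * u - v * v ≡ (u - v) * (u + v)
        difference-of-squares = solve-∀
... | inj₁ p∣u-v = inj₁ (mk≡mod p∣u-v)
... | inj₂ p∣u+v = inj₂ (mk≡mod (subst (+ p Signed.∣_) (regroup u v) p∣u+v))
  where regroup : ∀ u v → u + v ≡ u - - v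
        regroup = solve-∀

square-residue-unique : ∀ {p y z} → Prime p → 1 ≤ y → y ℕ.+ z < p →
                        + y * + y ≡ + z * + z mod p → y ≡ z
square-residue-unique {p} {y} {z} p-prime 1≤y y+z<p y²≡z²
  with prime-square-≡⇒± p-prime (+ y) (+ z) y²≡z²
... | inj₁ y≡z  = residue-unique (ℕ.≤-<-trans (ℕ.m≤m+n y z) y+z<p) (ℕ.≤-<-trans (ℕ.m≤n+m z y) y+z<p) y≡z
... | inj₂ y≡-z = contradiction (residue-unique y+z<p (ℕ.m<n⇒0<n y+z<p) y+z≡0) (ℕ.<⇒≢ 0<y+z ∘ sym)
  where
  0<y+z : 0 < y ℕ.+ z
  0<y+z = ℕ.≤-trans 1≤y (ℕ.m≤m+n y z)
  y+z≡0 : + (y ℕ.+ z) ≡ 0ℤ mod p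
  y+z≡0 = begin
    + (y ℕ.+ z)  ≡⟨ ℤ.pos-+ y z ⟩
    + y + + z    ≈⟨ +-congʳ-mod (+ z) y≡-z ⟩
    - + z + + z  ≡⟨ ℤ.+-inverseˡ (+ z) ⟩
    0ℤ           ∎
    where open ≡mod-Reasoning p

-- Counting residues

private variable
  P Q : Pred ℕ 0ℓ

count : Decidable P → ℕ → ℕ
count P? zero    = 0
count P? (suc n) = if does (P? n) then suc (count P? n) else count P? n

length-filter-upTo : (P? : Decidable P) (n : ℕ) → length (filter P? (upTo n)) ≡ count P? n
length-filter-upTo P? zero    = refl
length-filter-upTo P? (suc n) = begin
  length (filter P? (upTo (suc n)))                         ≡⟨ cong (length ∘ filter P?) (List.upTo-∷ʳ n) ⟨
  length (filter P? (upTo n ++ [ n ]))                      ≡⟨ cong length (List.filter-++ P? (upTo n) [ n ]) ⟩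
  length (filter P? (upTo n) ++ filter P? [ n ])            ≡⟨ List.length-++ (filter P? (upTo n)) ⟩
  length (filter P? (upTo n)) ℕ.+ length (filter P? [ n ])  ≡⟨ cong (ℕ._+ length (filter P? [ n ])) (length-filter-upTo P? n) ⟩
  count P? n ℕ.+ length (filter P? [ n ])                   ≡⟨ count-snoc ⟩
  count P? (suc n)                                          ∎
  where
  open ≡-Reasoning
  count-snoc : count P? n ℕ.+ length (filter P? [ n ]) ≡ count P? (suc n)
  count-snoc with P? n
  ... | yes _ = ℕ.+-comm (count P? n) 1
  ... | no  _ = ℕ.+-identityʳ (count P? n)

module _ (P? : Decidable P) where

  count-yes : ∀ {n} → P n → count P? (suc n) ≡ suc (count P? n)
  count-yes {n} Pn with P? n
  ... | yes _  = refl
  ... | no ¬Pn = contradiction Pn ¬Pn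

  count-no : ∀ {n} → ¬ P n → count P? (suc n) ≡ count P? n
  count-no {n} ¬Pn with P? n
  ... | yes Pn = contradiction Pn ¬Pn
  ... | no _   = refl

  count-witness : ∀ {n} → 0 < count P? n → ∃ λ r → r < n × P r
  count-witness {suc n} 0<count with P? n
  ... | yes Pn = n , ℕ.≤-refl , Pn
  ... | no _   = let r , r<n , Pr = count-witness 0<count in r , ℕ.m<n⇒m<1+n r<n , Pr

count-cong : ∀ (P? : Decidable P) (Q? : Decidable Q) n →
             (∀ {r} → r < n → P r → Q r) → (∀ {r} → r < n → Q r → P r) → count P? n ≡ count Q? n
count-cong P? Q? zero    _   _   = refl
count-cong P? Q? (suc n) P⇒Q Q⇒P with P? n | Q? n
... | yes _  | yes _  = cong suc (count-cong P? Q? n (P⇒Q ∘ ℕ.m<n⇒m<1+n) (Q⇒P ∘ ℕ.m<n⇒m<1+n))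
... | no _   | no _   = count-cong P? Q? n (P⇒Q ∘ ℕ.m<n⇒m<1+n) (Q⇒P ∘ ℕ.m<n⇒m<1+n)
... | yes Pn | no ¬Qn = contradiction (P⇒Q ℕ.≤-refl Pn) ¬Qn
... | no ¬Pn | yes Qn = contradiction (Q⇒P ℕ.≤-refl Qn) ¬Pn

delete? : Decidable P → (t : ℕ) → Decidable (P ∩ ∁ (_≡ t))
delete? P? t = P? ∩? ∁? (ℕ._≟ t)

count-delete : ∀ (P? : Decidable P) {n t} → t < n → P t → count P? n ≡ suc (count (delete? P? t) n)
count-delete {P = P} P? {suc n} {t} t<1+n Pt with t ℕ.≟ n
... | yes refl = begin
  count P? (suc t)                    ≡⟨ count-yes P? Pt ⟩
  suc (count P? t)                    ≡⟨ cong suc (count-cong P? (delete? P? t) t (λ r<t Pr → Pr , ℕ.<⇒≢ r<t) (λ _ → proj₁)) ⟩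
  suc (count (delete? P? t) t)        ≡⟨ cong suc (count-no (delete? P? t) (λ (_ , t≢t) → t≢t refl)) ⟨
  suc (count (delete? P? t) (suc t))  ∎
  where open ≡-Reasoning
... | no t≢n = top (P? n)
  where
  open ≡-Reasoning
  t<n : t < n
  t<n = ℕ.≤∧≢⇒< (ℕ.≤-pred t<1+n) t≢n
  top : Dec (P n) → count P? (suc n) ≡ suc (count (delete? P? t) (suc n))
  top (yes Pn) = begin
    count P? (suc n)                    ≡⟨ count-yes P? Pn ⟩
    suc (count P? n)                    ≡⟨ cong suc (count-delete P? t<n Pt) ⟩
    suc (suc (count (delete? P? t) n))  ≡⟨ cong suc (count-yes (delete? P? t) (Pn , t≢n ∘ sym)) ⟨
    suc (count (delete? P? t) (suc n))  ∎
  top (no ¬Pn) = begin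
    count P? (suc n)                    ≡⟨ count-no P? ¬Pn ⟩
    count P? n                          ≡⟨ count-delete P? t<n Pt ⟩
    suc (count (delete? P? t) n)        ≡⟨ cong suc (count-no (delete? P? t) (¬Pn ∘ proj₁)) ⟨
    suc (count (delete? P? t) (suc n))  ∎

witness⇒0<count : ∀ (P? : Decidable P) {n r} → r < n → P r → 0 < count P? n
witness⇒0<count P? r<n Pr = subst (0 <_) (sym (count-delete P? r<n Pr)) ℕ.z<s

count-delete-pair : ∀ (P? : Decidable P) {n x y} → x < n → y < n → P x → P y → y ≢ x →
                    count P? n ≡ 2 ℕ.+ count (delete? (delete? P? x) y) n
count-delete-pair P? {x = x} x<n y<n Px Py y≢x =
  trans (count-delete P? x<n Px) (cong suc (count-delete (delete? P? x) y<n (Py , y≢x)))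

count-≤-injection : ∀ (P? : Decidable P) (Q? : Decidable Q) {m n} (f : ℕ → ℕ) →
  (∀ {r} → r < m → P r → f r < n × Q (f r)) →
  (∀ {r r′} → r < m → r′ < m → f r ≡ f r′ → r ≡ r′) →
  count P? m ≤ count Q? n
count-≤-injection P? Q? {zero} f maps injective = z≤n
count-≤-injection {P = P} {Q = Q} P? Q? {suc m} {n} f maps injective = top (P? m)
  where
  maps-below : ∀ {r} → r < m → P r → f r < n × Q (f r)
  maps-below = maps ∘ ℕ.m<n⇒m<1+n
  injective-below : ∀ {r r′} → r < m → r′ < m → f r ≡ f r′ → r ≡ r′
  injective-below r<m r′<m = injective (ℕ.m<n⇒m<1+n r<m) (ℕ.m<n⇒m<1+n r′<m)
  top : Dec (P m) → count P? (suc m) ≤ count Q? n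
  top (no ¬Pm) = ℕ.≤-trans (ℕ.≤-reflexive (count-no P? ¬Pm))
                   (count-≤-injection P? Q? f maps-below injective-below)
  top (yes Pm) = begin
    count P? (suc m)                  ≡⟨ count-yes P? Pm ⟩
    suc (count P? m)                  ≤⟨ s≤s (count-≤-injection P? (delete? Q? (f m)) f maps-delete injective-below) ⟩
    suc (count (delete? Q? (f m)) n)  ≡⟨ count-delete Q? (proj₁ (maps ℕ.≤-refl Pm)) (proj₂ (maps ℕ.≤-refl Pm)) ⟨
    count Q? n                        ∎
    where
    open ℕ.≤-Reasoning
    maps-delete : ∀ {r} → r < m → P r → f r < n × (Q ∩ ∁ (_≡ f m)) (f r)
    maps-delete r<m Pr =
      let fr<n , Qfr = maps-below r<m Pr
      in fr<n , Qfr , ℕ.<⇒≢ r<m ∘ injective (ℕ.m<n⇒m<1+n r<m) ℕ.≤-refl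

count-2≤ : ∀ k → count (2 ℕ.≤?_) (suc k) ≡ k ℕ.∸ 1
count-2≤ zero          = refl
count-2≤ (suc zero)    = refl
count-2≤ (suc (suc k)) = trans (count-yes (2 ℕ.≤?_) {suc (suc k)} (s≤s (s≤s z≤n))) (cong suc (count-2≤ (suc k)))

module Pairing (R : ℕ → ℕ → Set) (R-sym : ∀ {x y} → R x y → R y x)
               (R-functional : ∀ {x y z} → R x y → R x z → y ≡ z) (n : ℕ) where

  PartnerClosed : Pred ℕ 0ℓ → Set
  PartnerClosed P = ∀ {x} → x < n → P x → ∃ λ y → y < n × P y × R x y

  HasFixedPoint : Pred ℕ 0ℓ → Set
  HasFixedPoint P = ∃ λ x → x < n × P x × R x x

  delete-pair-closed : ∀ {x y} → R x y → PartnerClosed P → PartnerClosed ((P ∩ ∁ (_≡ x)) ∩ ∁ (_≡ y))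
  delete-pair-closed Rxy closed z<n ((Pz , z≢x) , z≢y) =
    let w , w<n , Pw , Rzw = closed z<n Pz
    in w , w<n , ((Pw , λ w≡x → z≢y (sym (R-functional Rxy (R-sym (subst (R _) w≡x Rzw)))))
                      , λ w≡y → z≢x (sym (R-functional (R-sym Rxy) (R-sym (subst (R _) w≡y Rzw))))) , Rzw

  -- c only bounds the count, to make the recursion structural.
  fixed-point-or-even-bounded : ∀ (P? : Decidable P) c → count P? n ≤ c → PartnerClosed P →
                                HasFixedPoint P ⊎ ∃ λ q → count P? n ≡ 2 ℕ.* q
  fixed-point-or-even-bounded P? zero bound _ = inj₂ (0 , ℕ.n≤0⇒n≡0 bound)
  fixed-point-or-even-bounded P? (suc c) bound closed with count P? n ℕ.≟ 0
  ... | yes count≡0 = inj₂ (0 , count≡0)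
  ... | no count≢0 with count-witness P? (ℕ.n≢0⇒n>0 count≢0)
  ... | x , x<n , Px with closed x<n Px
  ... | y , y<n , Py , Rxy with y ℕ.≟ x
  ... | yes refl = inj₁ (y , y<n , Py , Rxy)
  ... | no y≢x with count-delete-pair P? x<n y<n Px Py y≢x
  ... | count≡2+count′
    with fixed-point-or-even-bounded (delete? (delete? P? x) y) c
           (ℕ.≤-pred (ℕ.m+n≤o⇒n≤o 1 (subst (_≤ suc c) count≡2+count′ bound)))
           (delete-pair-closed Rxy closed)
  ... | inj₁ (z , z<n , ((Pz , _) , _) , Rzz) = inj₁ (z , z<n , Pz , Rzz)
  ... | inj₂ (q , count′≡2q) =
    inj₂ (suc q , trans count≡2+count′ (trans (cong (2 ℕ.+_) count′≡2q) (sym (ℕ.*-suc 2 q))))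

  fixed-point-or-even : ∀ (P? : Decidable P) → PartnerClosed P →
                        HasFixedPoint P ⊎ ∃ λ q → count P? n ≡ 2 ℕ.* q
  fixed-point-or-even P? = fixed-point-or-even-bounded P? _ ℕ.≤-refl

-- A square root of −1 modulo a prime p = 2m + 1 with m even

module SquareRootOfMinusOne (p m : ℕ) (p-prime : Prime p) (p≡1+2m : p ≡ suc (2 ℕ.* m)) where

  instance
    p≢0 : NonZero p
    p≢0 = prime⇒nonZero p-prime

  1<p : 1 < p
  1<p = ℕ.nonTrivial⇒n>1 p {{prime⇒nonTrivial p-prime}}

  Half : ℕ → Set
  Half y = 1 ≤ y × y ≤ m

  half+half<p : ∀ {y z} → y ≤ m → z ≤ m → y ℕ.+ z < p
  half+half<p {y} {z} y≤m z≤m = subst (y ℕ.+ z <_) (sym p≡1+2m)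
    (s≤s (subst (y ℕ.+ z ≤_) (cong (m ℕ.+_) (sym (ℕ.+-identityʳ m))) (ℕ.+-mono-≤ y≤m z≤m)))

  half<p : ∀ {y} → y ≤ m → y < p
  half<p {y} y≤m = ℕ.≤-<-trans (ℕ.m≤m+n y y) (half+half<p y≤m y≤m)

  p∸1+m≡m : p ℕ.∸ suc m ≡ m
  p∸1+m≡m = begin
    p ℕ.∸ suc m              ≡⟨ cong (ℕ._∸ suc m) p≡1+2m ⟩
    (m ℕ.+ (m ℕ.+ 0)) ℕ.∸ m  ≡⟨ ℕ.m+n∸m≡n m (m ℕ.+ 0) ⟩
    m ℕ.+ 0                  ≡⟨ ℕ.+-identityʳ m ⟩
    m                        ∎
    where open ≡-Reasoning

  half-square-unique : ∀ {y z} → Half y → Half z → + y * + y ≡ + z * + z mod p → y ≡ z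
  half-square-unique (1≤y , y≤m) (_ , z≤m) = square-residue-unique p-prime 1≤y (half+half<p y≤m z≤m)

  square-≢1 : ∀ {x} → 2 ≤ x → x ≤ m → ¬ + x * + x ≡ 1ℤ mod p
  square-≢1 {x} 2≤x x≤m x²≡1 =
    ℕ.<⇒≢ 2≤x (sym (half-square-unique (1≤x , x≤m) (ℕ.≤-refl , ℕ.≤-trans 1≤x x≤m) x²≡1))
    where 1≤x : 1 ≤ x
          1≤x = ℕ.<⇒≤ 2≤x

  0≢1-mod : ¬ 0ℤ ≡ 1ℤ mod p
  0≢1-mod 0≡1 = ℕ.0≢1+n (residue-unique (ℕ.<-trans ℕ.0<1+n 1<p) 1<p 0≡1)

  -- x and y are partners when xy ≡ ±1, which for a prime is (xy)² ≡ 1.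
  Partner : ℕ → ℕ → Set
  Partner x y = Half x × Half y × (+ x * + y) * (+ x * + y) ≡ 1ℤ mod p

  partner-sym : ∀ {x y} → Partner x y → Partner y x
  partner-sym {x} {y} (hx , hy , xy²≡1) = hy , hx , subst (_≡ 1ℤ mod p) (swap (+ x) (+ y)) xy²≡1
    where swap : ∀ x y → (x * y) * (x * y) ≡ (y * x) * (y * x)
          swap = solve-∀

  partner-functional : ∀ {x y z} → Partner x y → Partner x z → y ≡ z
  partner-functional {x} {y} {z} (_ , hy , xy²≡1) (_ , hz , xz²≡1) = half-square-unique hy hz (begin
    Y * Y                        ≡⟨ ℤ.*-identityʳ (Y * Y) ⟨
    Y * Y * 1ℤ                   ≈⟨ *-congˡ-mod (Y * Y) (≡mod-sym xz²≡1) ⟩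
    Y * Y * ((X * Z) * (X * Z))  ≡⟨ regroup X Y Z ⟩
    Z * Z * ((X * Y) * (X * Y))  ≈⟨ *-congˡ-mod (Z * Z) xy²≡1 ⟩
    Z * Z * 1ℤ                   ≡⟨ ℤ.*-identityʳ (Z * Z) ⟩
    Z * Z                        ∎)
    where
    open ≡mod-Reasoning p
    X = + x ; Y = + y ; Z = + z
    regroup : ∀ X Y Z → Y * Y * ((X * Z) * (X * Z)) ≡ Z * Z * ((X * Y) * (X * Y))
    regroup = solve-∀

  ±1-square : ∀ {w} → w ≡ 1ℤ mod p ⊎ w ≡ -1ℤ mod p → w * w ≡ 1ℤ mod p
  ±1-square (inj₁ w≡1)  = *-cong-mod w≡1 w≡1
  ±1-square (inj₂ w≡-1) = *-cong-mod w≡-1 w≡-1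

  -- The partner is ±x⁻¹, with the sign chosen to land in {1,…,m}.
  partner-exists : ∀ {x} → Half x → ∃ (Partner x)
  partner-exists {x} hx@(1≤x , x≤m)
    with coprime⇒inverse-mod (Coprime.sym (prime⇒coprime p-prime {{ℕ.>-nonZero 1≤x}} (half<p x≤m)))
  ... | u , xu≡1 = from-residue (u %ℕ p) (n%ℕd<d u p) (%ℕ-≡mod u)
    where
    open ≡mod-Reasoning p
    from-residue : ∀ r → r < p → + r ≡ u mod p → ∃ (Partner x)
    from-residue zero _ 0≡u = contradiction (begin
      0ℤ        ≡⟨ ℤ.*-zeroʳ (+ x) ⟨
      + x * 0ℤ  ≈⟨ *-congˡ-mod (+ x) 0≡u ⟩
      + x * u   ≈⟨ xu≡1 ⟩
      1ℤ        ∎) 0≢1-mod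
    from-residue r@(suc _) r<p r≡u with r ℕ.≤? m
    ... | yes r≤m = r , hx , (s≤s z≤n , r≤m) , ±1-square (inj₁ (begin
      + x * + r  ≈⟨ *-congˡ-mod (+ x) r≡u ⟩
      + x * u    ≈⟨ xu≡1 ⟩
      1ℤ         ∎))
    ... | no r≰m = p ℕ.∸ r , hx , (ℕ.m<n⇒0<n∸m r<p , p∸r≤m) , ±1-square (inj₂ (begin
      + x * + (p ℕ.∸ r)  ≈⟨ *-congˡ-mod (+ x) (∸-≡mod (ℕ.<⇒≤ r<p)) ⟩
      + x * - + r        ≈⟨ *-congˡ-mod (+ x) (neg-cong-mod r≡u) ⟩
      + x * - u          ≡⟨ ℤ.neg-distribʳ-* (+ x) u ⟨
      - (+ x * u)        ≈⟨ neg-cong-mod xu≡1 ⟩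
      -1ℤ                ∎))
      where p∸r≤m : p ℕ.∸ r ≤ m
            p∸r≤m = ℕ.≤-trans (ℕ.∸-monoʳ-≤ p (ℕ.≰⇒> r≰m)) (ℕ.≤-reflexive p∸1+m≡m)

  partner-≢1 : ∀ {x} → 2 ≤ x → ¬ Partner x 1
  partner-≢1 {x} 2≤x ((_ , x≤m) , _ , x1²≡1) =
    square-≢1 2≤x x≤m (subst (λ w → w * w ≡ 1ℤ mod p) (ℤ.*-identityʳ (+ x)) x1²≡1)

  self-partner-square : ∀ {x} → 2 ≤ x → Partner x x → + x * + x ≡ -1ℤ mod p
  self-partner-square {x} 2≤x ((_ , x≤m) , _ , x⁴≡1) with prime-square-≡⇒± p-prime (+ x * + x) 1ℤ x⁴≡1
  ... | inj₁ x²≡1  = contradiction x²≡1 (square-≢1 2≤x x≤m)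
  ... | inj₂ x²≡-1 = x²≡-1

  open Pairing Partner partner-sym partner-functional (suc m)

  partner-closed : PartnerClosed (2 ≤_)
  partner-closed {x} x<1+m 2≤x =
    let y , Pxy@(_ , (1≤y , y≤m) , _) = partner-exists (ℕ.≤-trans (s≤s z≤n) 2≤x , ℕ.≤-pred x<1+m)
    in y , s≤s y≤m , ℕ.≤∧≢⇒< 1≤y (λ 1≡y → partner-≢1 2≤x (subst (Partner x) (sym 1≡y) Pxy)) , Pxy

  m∸1-odd : ∀ s q → m ≡ 2 ℕ.* s → m ℕ.∸ 1 ≢ 2 ℕ.* q
  m∸1-odd zero    _ m≡0    _      = ℕ.<-irrefl (sym (trans p≡1+2m (cong (suc ∘ (2 ℕ.*_)) m≡0))) 1<p
  m∸1-odd (suc t) q m≡2+2t m∸1≡2q =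
    ℕ.even≢odd q t (sym (trans (sym (cong (ℕ._∸ 1) (trans m≡2+2t (ℕ.*-suc 2 t)))) m∸1≡2q))

  minus-one-square : ∀ s → m ≡ 2 ℕ.* s → ∃ λ i → i * i ≡ -1ℤ mod p
  minus-one-square s m≡2s = from-pairing (fixed-point-or-even (2 ℕ.≤?_) partner-closed)
    where
    from-pairing : HasFixedPoint (2 ≤_) ⊎ (∃ λ q → count (2 ℕ.≤?_) (suc m) ≡ 2 ℕ.* q) →
                   ∃ λ i → i * i ≡ -1ℤ mod p
    from-pairing (inj₁ (x , _ , 2≤x , Pxx)) = + x , self-partner-square 2≤x Pxx
    from-pairing (inj₂ (q , count≡2q)) =
      contradiction (trans (sym (count-2≤ m)) count≡2q) (m∸1-odd s q m≡2s)

-- Lifting a square root of −1 to prime powers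

-- With i² + 1 = cq, q = rp and 2h = 1 + tp, the choice i′ = i(1 + hcq) gives
-- i′² + 1 = cq(q(2hc + h²c²q − h²c) − (2h − 1)), which is divisible by pq.
lift-minus-one-square : ∀ {p q h i} → p ℕ.∣ q → + 2 * h ≡ 1ℤ mod p → i * i ≡ -1ℤ mod q →
                        ∃ λ i′ → i′ * i′ ≡ -1ℤ mod p ℕ.* q
lift-minus-one-square {p} {q} {h} {i} (ℕ.divides r q≡rp) (mk≡mod (divides t 2h-1≡tp))
                      (mk≡mod (divides c i²+1≡cq)) =
  i * L , mk≡mod (divides (c * (rℤ * K - t)) (begin
    (i * L) * (i * L) - -1ℤ                  ≡⟨ expand i h c qℤ ⟩
    (i * i - -1ℤ) * (L * L) - h * c * qℤ * (+ 2 + h * c * qℤ)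
                                             ≡⟨ cong (λ e → e * (L * L) - h * c * qℤ * (+ 2 + h * c * qℤ)) i²+1≡cq ⟩
    c * qℤ * (L * L) - h * c * qℤ * (+ 2 + h * c * qℤ)
                                             ≡⟨ collect h c qℤ ⟩
    c * qℤ * (qℤ * K - (+ 2 * h - 1ℤ))       ≡⟨ cong₂ (λ q′ e → c * qℤ * (q′ * K - e)) qℤ≡rℤ*pℤ 2h-1≡tp ⟩
    c * qℤ * (rℤ * pℤ * K - t * pℤ)          ≡⟨ factor c qℤ rℤ pℤ K t ⟩
    c * (rℤ * K - t) * (pℤ * qℤ)             ≡⟨ cong (c * (rℤ * K - t) *_) (ℤ.pos-* p q) ⟨
    c * (rℤ * K - t) * + (p ℕ.* q)           ∎))
  where
  open ≡-Reasoning
  pℤ qℤ rℤ L K : ℤ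
  pℤ = + p
  qℤ = + q
  rℤ = + r
  L  = 1ℤ + h * c * qℤ
  K  = + 2 * h * c + h * h * c * c * qℤ - h * h * c
  qℤ≡rℤ*pℤ : qℤ ≡ rℤ * pℤ
  qℤ≡rℤ*pℤ = trans (cong +_ q≡rp) (ℤ.pos-* r p)
  expand : ∀ i h c q → (i * (1ℤ + h * c * q)) * (i * (1ℤ + h * c * q)) - -1ℤ
                     ≡ (i * i - -1ℤ) * ((1ℤ + h * c * q) * (1ℤ + h * c * q)) - h * c * q * (+ 2 + h * c * q)
  expand = solve-∀
  collect : ∀ h c q → c * q * ((1ℤ + h * c * q) * (1ℤ + h * c * q)) - h * c * q * (+ 2 + h * c * q)
                    ≡ c * q * (q * (+ 2 * h * c + h * h * c * c * q - h * h * c) - (+ 2 * h - 1ℤ))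
  collect = solve-∀
  factor : ∀ c q r p k t → c * q * (r * p * k - t * p) ≡ c * (r * k - t) * (p * q)
  factor = solve-∀

minus-one-square-mod-power : ∀ {p h} → + 2 * h ≡ 1ℤ mod p → (∃ λ i → i * i ≡ -1ℤ mod p) →
                             ∀ j → ∃ λ i → i * i ≡ -1ℤ mod p ^ suc j
minus-one-square-mod-power {p} _ (i , i²≡-1) zero =
  i , subst (i * i ≡ -1ℤ mod_) (sym (ℕ.*-identityʳ p)) i²≡-1
minus-one-square-mod-power {p} 2h≡1 root (suc j) =
  let i , i²≡-1 = minus-one-square-mod-power 2h≡1 root j
  in lift-minus-one-square {i = i} (ℕ.m∣m*n (p ^ j)) 2h≡1 i²≡-1

2*-m≡1 : ∀ m → + 2 * - + m ≡ 1ℤ mod suc (2 ℕ.* m)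
2*-m≡1 m = mk≡mod (divides -1ℤ (trans (regroup (+ m)) (cong (-1ℤ *_) (sym (pos-1+m*n 2 m)))))
  where regroup : ∀ m → + 2 * - m - 1ℤ ≡ -1ℤ * (1ℤ + + 2 * m)
        regroup = solve-∀

-- Sums and differences on the modular hyperbola

n/n≡1 : ∀ n → + suc n / suc n ≡ 1ℚ
n/n≡1 n = fromℚᵘ-cong {mkℚᵘ (+ suc n) n} {mkℚᵘ 1ℤ 0} (*≡* (ℤ.*-comm (+ suc n) 1ℤ))

module ModularHyperbola (a : ℤ) (n : ℕ) .{{_ : NonZero n}} where

  record OnHyperbola (x y : ℕ) : Set where
    field
      1≤x : 1 ≤ x
      x<n : x < n
      1≤y : 1 ≤ y
      y<n : y < n
      xy≡a : (x ℕ.* y) % n ≡ a modℤ n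

  ∈-range1⁺ : ∀ {x} → 1 ≤ x → x < n → x ∈ range1 n
  ∈-range1⁺ 1≤x x<n = ∈-filter⁺ (1 ℕ.≤?_) (∈-upTo⁺ x<n) 1≤x

  ∈-range1⁻ : ∀ {x} → x ∈ range1 n → 1 ≤ x × x < n
  ∈-range1⁻ x∈ = let x∈upTo , 1≤x = ∈-filter⁻ (1 ℕ.≤?_) x∈ in 1≤x , ∈-upTo⁻ x∈upTo

  ∈-H₂⁺ : ∀ {x y} → OnHyperbola x y → (x , y) ∈ H₂ a n
  ∈-H₂⁺ {x} {y} h = ∈-filter⁺ (λ xy → ((proj₁ xy ℕ.* proj₂ xy) % n) ℕ.≟ (a modℤ n))
    (∈-concatMap⁺ (λ x → map (x ,_) (range1 n))
      (lose (∈-range1⁺ 1≤x x<n) (∈-map⁺ (x ,_) (∈-range1⁺ 1≤y y<n))))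
    xy≡a
    where open OnHyperbola h

  ∈-H₂⁻ : ∀ {x y} → (x , y) ∈ H₂ a n → OnHyperbola x y
  ∈-H₂⁻ xy∈ with ∈-filter⁻ (λ xy → ((proj₁ xy ℕ.* proj₂ xy) % n) ℕ.≟ (a modℤ n)) xy∈
  ... | xy∈pairs , xy≡a with find (∈-concatMap⁻ (λ x → map (x ,_) (range1 n)) {xs = range1 n} xy∈pairs)
  ... | x , x∈ , xy∈row with ∈-map⁻ (x ,_) xy∈row
  ... | y , y∈ , refl = record
    { 1≤x = proj₁ (∈-range1⁻ x∈) ; x<n = proj₂ (∈-range1⁻ x∈)
    ; 1≤y = proj₁ (∈-range1⁻ y∈) ; y<n = proj₂ (∈-range1⁻ y∈)
    ; xy≡a = xy≡a }

  IsSum : ℕ → Set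
  IsSum r = Any (λ xy → (proj₁ xy ℕ.+ proj₂ xy) % n ≡ r) (H₂ a n)

  IsSum? : Decidable IsSum
  IsSum? r = any? (λ xy → ((proj₁ xy ℕ.+ proj₂ xy) % n) ℕ.≟ r) (H₂ a n)

  IsDiff : ℕ → Set
  IsDiff r = Any (λ xy → (proj₁ xy ℕ.+ (n ℕ.∸ proj₂ xy)) % n ≡ r) (H₂ a n)

  IsDiff? : Decidable IsDiff
  IsDiff? r = any? (λ xy → ((proj₁ xy ℕ.+ (n ℕ.∸ proj₂ xy)) % n) ℕ.≟ r) (H₂ a n)

  length-S̄₂ : length (S̄₂ a n) ≡ count IsSum? n
  length-S̄₂ = length-filter-upTo IsSum? n

  length-D̄₂ : length (D̄₂ a n) ≡ count IsDiff? n
  length-D̄₂ = length-filter-upTo IsDiff? n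

  difference-≡mod : ∀ {x y} → y < n → + (x ℕ.+ (n ℕ.∸ y)) ≡ + x - + y mod n
  difference-≡mod {x} {y} y<n =
    ≡mod-trans (≡⇒≡mod (ℤ.pos-+ x (n ℕ.∸ y))) (+-congˡ-mod (+ x) (∸-≡mod (ℕ.<⇒≤ y<n)))

  sum-intro : ∀ {x y r} → OnHyperbola x y → r < n → + x + + y ≡ + r mod n → IsSum r
  sum-intro {x} {y} h r<n x+y≡r =
    lose (∈-H₂⁺ h) (≡mod⇒%≡ n r<n (≡mod-trans (≡⇒≡mod (ℤ.pos-+ x y)) x+y≡r))

  sum-elim : ∀ {r} → IsSum r → ∃₂ λ x y → OnHyperbola x y × + x + + y ≡ + r mod n
  sum-elim s with find s
  ... | (x , y) , xy∈ , x+y%n≡r =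
    x , y , ∈-H₂⁻ xy∈ , ≡mod-trans (≡⇒≡mod (sym (ℤ.pos-+ x y))) (%≡⇒≡mod n x+y%n≡r)

  diff-intro : ∀ {x y r} → OnHyperbola x y → r < n → + x - + y ≡ + r mod n → IsDiff r
  diff-intro h r<n x-y≡r =
    lose (∈-H₂⁺ h) (≡mod⇒%≡ n r<n (≡mod-trans (difference-≡mod (OnHyperbola.y<n h)) x-y≡r))

  diff-elim : ∀ {r} → IsDiff r → ∃₂ λ x y → OnHyperbola x y × + x - + y ≡ + r mod n
  diff-elim d with find d
  ... | (x , y) , xy∈ , x-y%n≡r =
    x , y , h , ≡mod-trans (≡mod-sym (difference-≡mod (OnHyperbola.y<n h))) (%≡⇒≡mod n x-y%n≡r)
    where h : OnHyperbola x y
          h = ∈-H₂⁻ xy∈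

  product-≡mod : ∀ J K x y → J * K ≡ 1ℤ mod n →
                 + ((J * + x) %ℕ n ℕ.* ((K * + y) %ℕ n)) ≡ + (x ℕ.* y) mod n
  product-≡mod J K x y JK≡1 = begin
    + ((J * + x) %ℕ n ℕ.* ((K * + y) %ℕ n))      ≡⟨ ℤ.pos-* ((J * + x) %ℕ n) ((K * + y) %ℕ n) ⟩
    + ((J * + x) %ℕ n) * + ((K * + y) %ℕ n)    ≈⟨ *-cong-mod (%ℕ-≡mod (J * + x)) (%ℕ-≡mod (K * + y)) ⟩
    (J * + x) * (K * + y)                      ≡⟨ regroup J K (+ x) (+ y) ⟩
    (J * K) * (+ x * + y)                      ≈⟨ *-congʳ-mod (+ x * + y) JK≡1 ⟩
    1ℤ * (+ x * + y)                           ≡⟨ trans (ℤ.*-identityˡ (+ x * + y)) (sym (ℤ.pos-* x y)) ⟩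
    + (x ℕ.* y)                                ∎
    where
    open ≡mod-Reasoning n
    regroup : ∀ J K X Y → (J * X) * (K * Y) ≡ (J * K) * (X * Y)
    regroup = solve-∀

  scale : ∀ J K {x y} → J * K ≡ 1ℤ mod n → a modℤ n ≢ 0 →
          OnHyperbola x y → OnHyperbola ((J * + x) %ℕ n) ((K * + y) %ℕ n)
  scale J K {x} {y} JK≡1 a≢0 h = record
    { 1≤x = ℕ.n≢0⇒n>0 λ x′≡0 → product≢0 (cong (ℕ._* y′) x′≡0)
    ; x<n = n%ℕd<d (J * + x) n
    ; 1≤y = ℕ.n≢0⇒n>0 λ y′≡0 → product≢0 (trans (cong (x′ ℕ.*_) y′≡0) (ℕ.*-zeroʳ x′))
    ; y<n = n%ℕd<d (K * + y) n
    ; xy≡a = x′y′≡a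
    }
    where
    x′ y′ : ℕ
    x′ = (J * + x) %ℕ n
    y′ = (K * + y) %ℕ n
    x′y′≡a : (x′ ℕ.* y′) % n ≡ a modℤ n
    x′y′≡a = trans (≡mod⇒%-≡ n (product-≡mod J K x y JK≡1)) (OnHyperbola.xy≡a h)
    product≢0 : x′ ℕ.* y′ ≢ 0
    product≢0 x′y′≡0 = a≢0 (trans (sym x′y′≡a) (trans (cong (_% n) x′y′≡0) (m*n%n≡0 0 n)))

  equal-lengths⇒c₂≡1 : length (S̄₂ a n) ≡ length (D̄₂ a n) → 0 < length (D̄₂ a n) → c₂ a n ≡ 1ℚ
  equal-lengths⇒c₂≡1 #S≡#D 0<#D with length (D̄₂ a n)
  ... | suc d = trans (cong (λ s → + s / suc d) #S≡#D) (n/n≡1 d)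

  module _ {i : ℤ} (i²≡-1 : i * i ≡ -1ℤ mod n) (a≢0 : a modℤ n ≢ 0) where

    open ≡mod-Reasoning n

    i*-i≡1 : i * - i ≡ 1ℤ mod n
    i*-i≡1 = begin
      i * - i    ≡⟨ ℤ.neg-distribʳ-* i i ⟨
      - (i * i)  ≈⟨ neg-cong-mod i²≡-1 ⟩
      1ℤ         ∎

    -i*i≡1 : - i * i ≡ 1ℤ mod n
    -i*i≡1 = subst (_≡ 1ℤ mod n) (ℤ.*-comm i (- i)) i*-i≡1

    diff⇒sum : ∀ {r} → r < n → IsDiff r → (i * + r) %ℕ n < n × IsSum ((i * + r) %ℕ n)
    diff⇒sum {r} _ d =
      let x , y , h , x-y≡r = diff-elim d in
      n%ℕd<d (i * + r) n , sum-intro (scale i (- i) i*-i≡1 a≢0 h) (n%ℕd<d (i * + r) n) (begin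
      + ((i * + x) %ℕ n) + + ((- i * + y) %ℕ n)  ≈⟨ +-cong-mod (%ℕ-≡mod (i * + x)) (%ℕ-≡mod (- i * + y)) ⟩
      i * + x + - i * + y                        ≡⟨ factor i (+ x) (+ y) ⟩
      i * (+ x - + y)                            ≈⟨ *-congˡ-mod i x-y≡r ⟩
      i * + r                                    ≈⟨ %ℕ-≡mod (i * + r) ⟨
      + ((i * + r) %ℕ n)                         ∎)
      where factor : ∀ i x y → i * x + - i * y ≡ i * (x - y)
            factor = solve-∀

    sum⇒diff : ∀ {r} → r < n → IsSum r → (- i * + r) %ℕ n < n × IsDiff ((- i * + r) %ℕ n)
    sum⇒diff {r} _ s =
      let x , y , h , x+y≡r = sum-elim s in
      n%ℕd<d (- i * + r) n , diff-intro (scale (- i) i -i*i≡1 a≢0 h) (n%ℕd<d (- i * + r) n) (begin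
      + ((- i * + x) %ℕ n) - + ((i * + y) %ℕ n)  ≈⟨ +-cong-mod (%ℕ-≡mod (- i * + x)) (neg-cong-mod (%ℕ-≡mod (i * + y))) ⟩
      - i * + x - i * + y                        ≡⟨ factor i (+ x) (+ y) ⟩
      - i * (+ x + + y)                          ≈⟨ *-congˡ-mod (- i) x+y≡r ⟩
      - i * + r                                  ≈⟨ %ℕ-≡mod (- i * + r) ⟨
      + ((- i * + r) %ℕ n)                       ∎)
      where factor : ∀ i x y → - i * x - i * y ≡ - i * (x + y)
            factor = solve-∀

    count-diff≡count-sum : count IsDiff? n ≡ count IsSum? n
    count-diff≡count-sum = ℕ.≤-antisym
      (count-≤-injection IsDiff? IsSum? (λ r → (i * + r) %ℕ n) diff⇒sum (unit-scaling-injective (- i) i -i*i≡1))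
      (count-≤-injection IsSum? IsDiff? (λ r → (- i * + r) %ℕ n) sum⇒diff (unit-scaling-injective i (- i) i*-i≡1))

    0<count-diff : 0 < count IsDiff? n
    0<count-diff = witness⇒0<count IsDiff? (n%ℕd<d (1ℤ - + A) n)
                     (diff-intro point (n%ℕd<d (1ℤ - + A) n) (≡mod-sym (%ℕ-≡mod (1ℤ - + A))))
      where
      A : ℕ
      A = a modℤ n
      1≤A : 1 ≤ A
      1≤A = ℕ.n≢0⇒n>0 a≢0
      point : OnHyperbola 1 A
      point = record
        { 1≤x = ℕ.≤-refl ; x<n = ℕ.≤-<-trans 1≤A (n%ℕd<d a n) ; 1≤y = 1≤A ; y<n = n%ℕd<d a n
        ; xy≡a = trans (cong (_% n) (ℕ.*-identityˡ A)) (m<n⇒m%n≡m (n%ℕd<d a n)) }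

    square-root-of-minus-one⇒c₂≡1 : c₂ a n ≡ 1ℚ
    square-root-of-minus-one⇒c₂≡1 = equal-lengths⇒c₂≡1
      (trans length-S̄₂ (trans (sym count-diff≡count-sum) (sym length-D̄₂)))
      (subst (0 <_) (sym length-D̄₂) 0<count-diff)

p≡1+2[2[p/4]] : ∀ p → p % 4 ≡ 1 → p ≡ suc (2 ℕ.* (2 ℕ.* (p ℕ./ 4)))
p≡1+2[2[p/4]] p p%4≡1 = begin
  p                             ≡⟨ m≡m%n+[m/n]*n p 4 ⟩
  p % 4 ℕ.+ p ℕ./ 4 ℕ.* 4       ≡⟨ cong (ℕ._+ p ℕ./ 4 ℕ.* 4) p%4≡1 ⟩
  suc (p ℕ./ 4 ℕ.* 4)           ≡⟨ cong suc (trans (ℕ.*-comm (p ℕ./ 4) 4) (ℕ.*-assoc 2 2 (p ℕ./ 4))) ⟩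
  suc (2 ℕ.* (2 ℕ.* (p ℕ./ 4))) ∎
  where open ≡-Reasoning

%ℕ≡0⇒∣ : ∀ {n} .{{_ : NonZero n}} a → a %ℕ n ≡ 0 → n ℕ.∣ ℤ.∣ a ∣
%ℕ≡0⇒∣ a a%n≡0 = ∣⇒∣ᵤ (≡0-mod⇒∣ (≡mod-sym (subst (λ r → + r ≡ a mod _) a%n≡0 (%ℕ-≡mod a))))

corollary3p7 : (p k : ℕ) → (pp : Prime p) → p % 4 ≡ 1 → 1 ≤ k → (a : ℤ) → ¬ ((+ p) ∣ a)
    → c₂ a (p ^ k) {{m^n≢0 p k {{prime⇒nonZero pp}}}} ≡ 1ℚ
corollary3p7 p (suc j) p-prime p%4≡1 _ a p∤a =
  ModularHyperbola.square-root-of-minus-one⇒c₂≡1 a (p ^ suc j) {proj₁ root} (proj₂ root) a≢0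
  where
  instance
    p≢0 : NonZero p
    p≢0 = prime⇒nonZero p-prime
    p^[1+j]≢0 : NonZero (p ^ suc j)
    p^[1+j]≢0 = m^n≢0 p (suc j)
  m : ℕ
  m = 2 ℕ.* (p ℕ./ 4)
  p≡1+2m : p ≡ suc (2 ℕ.* m)
  p≡1+2m = p≡1+2[2[p/4]] p p%4≡1
  root : ∃ λ i → i * i ≡ -1ℤ mod p ^ suc j
  root = minus-one-square-mod-power (subst (+ 2 * - + m ≡ 1ℤ mod_) (sym p≡1+2m) (2*-m≡1 m))
           (SquareRootOfMinusOne.minus-one-square p m p-prime p≡1+2m (p ℕ./ 4) refl) j
  a≢0 : a modℤ (p ^ suc j) ≢ 0
  a≢0 a%n≡0 = p∤a (ℕ.∣-trans (ℕ.m∣m*n (p ^ j)) (%ℕ≡0⇒∣ {p ^ suc j} a a%n≡0))
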